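{- Let $B\in\mathbb{Z}^{\tilde n\times\tilde n}$ be nonsingular with columns $B_1,\ldots,B_{\tilde n}$, let $C\in\mathbb{Z}^{\tilde n\times\tilde m}$ with columns $C_1,\ldots,C_{\tilde m}$, and let $X=B^{ -1}C\in\mathbb{Q}^{\tilde n\times \tilde m}$. Fix indices $i\le\tilde n$ and $j\le\tilde m$ such that $X_{ij}\notin\mathbb{Z}$. Define $B'$ from $B$ by replacing its $i$-th column with $$B'_i:=C_j-\Big(\sum_{k\neq i}B_k\lfloor X_{kj}\rfloor+B_i\lceil X_{ij}\rfloor\Big)$$ (all other columns unchanged), and define $C'$ from $C$ by replacing its $j$-th column by $B_i$ (all other columns unchanged). Then $X':=(B')^{ -1}C'$ is given by $$X'_{ij}=\frac{1}{X_{ij}-\lceil X_{ij}\rfloor},\qquad X'_{i\ell}=\frac{X_{i\ell}}{X_{ij}-\lceil X_{ij}\rfloor}\ (\ell\neq j),$$ $$X'_{kj}=\frac{ -\{X_{kj}\}}{X_{ij}-\lceil X_{ij}\rfloor}\ (k\neq i),\qquad X'_{k\ell}=X_{k\ell}-\frac{X_{i\ell}\{X_{kj}\}}{X_{ij}-\lceil X_{ij}\rfloor}\ (\ell\neq j,\ k\neq i).$$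
   Context: For $z\in\mathbb{R}$: $\lfloor z\rfloor$ is the floor, $\{z\}=z-\lfloor z\rfloor$ is the fractional part, and $\lceil z\rfloor=\lfloor z+1/2\rfloor$ is the nearest integer. -}

module Defs where

open import Data.Nat using (ℕ)
open import Data.Integer as ℤ using (ℤ)
open import Data.Rational as ℚ using (ℚ; 0ℚ; 1ℚ; ½; floor; _/_; _÷_; ≢-nonZero)
open import Data.Rational.Properties using (_≟_)
open import Data.Fin as Fin using (Fin; zero; suc)
import Data.Fin.Properties as FinP
open import Data.Product using (Σ; ∃; _×_)
open import Relation.Nullary using (yes; no; ¬_)
open import Relation.Binary.PropositionalEquality using (_≡_)

Mat : Set → ℕ → ℕ → Set
Mat R n m = Fin n → Fin m → R

sumℚ : ∀ {n} → (Fin n → ℚ) → ℚ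
sumℚ {ℕ.zero} f = 0ℚ
sumℚ {ℕ.suc n} f = f zero ℚ.+ sumℚ (λ k → f (suc k))

sumℤ : ∀ {n} → (Fin n → ℤ) → ℤ
sumℤ {ℕ.zero} f = ℤ.+ 0
sumℤ {ℕ.suc n} f = f zero ℤ.+ sumℤ (λ k → f (suc k))

_⊗_ : ∀ {n m p} → Mat ℚ n m → Mat ℚ m p → Mat ℚ n p
(A ⊗ B) r c = sumℚ (λ k → A r k ℚ.* B k c)

Id : ∀ {n} → Mat ℚ n n
Id r c with r FinP.≟ c
... | yes _ = 1ℚ
... | no _ = 0ℚ

toℚ : ℤ → ℚ
toℚ z = z / 1

toℚMat : ∀ {n m} → Mat ℤ n m → Mat ℚ n m
toℚMat A r c = toℚ (A r c)

IsInverse : ∀ {n} → Mat ℚ n n → Mat ℚ n n → Set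
IsInverse A A' = (∀ r c → (A ⊗ A') r c ≡ Id r c) × (∀ r c → (A' ⊗ A) r c ≡ Id r c)

IsInt : ℚ → Set
IsInt x = ∃ λ (z : ℤ) → x ≡ toℚ z

-- paper's conventions: nearest integer ⌈z⌋ = ⌊z + 1/2⌋, fractional part {z} = z - ⌊z⌋
nearest : ℚ → ℤ
nearest z = floor (z ℚ.+ ½)

frac : ℚ → ℚ
frac z = z ℚ.- toℚ (floor z)

-- total division: p / q for q ≠ 0 (and 0 when q = 0; only used with q ≠ 0)
divℚ : ℚ → ℚ → ℚ
divℚ p q with q ≟ 0ℚ
... | yes _ = 0ℚ
... | no q≢0 = _÷_ p q {{≢-nonZero q≢0}}

coeff : ∀ {n m} → Mat ℚ n m → Fin n → Fin m → Fin n → ℤ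
coeff X i j k with k FinP.≟ i
... | yes _ = nearest (X i j)
... | no _ = floor (X k j)

B′ : ∀ {n m} → Mat ℤ n n → Mat ℤ n m → Mat ℚ n m → Fin n → Fin m → Mat ℤ n n
B′ B C X i j r c with c FinP.≟ i
... | yes _ = C r j ℤ.- sumℤ (λ k → B r k ℤ.* coeff X i j k)
... | no _ = B r c

C′ : ∀ {n m} → Mat ℤ n n → Mat ℤ n m → Fin n → Fin m → Mat ℤ n m
C′ B C i j r c with c FinP.≟ j
... | yes _ = B r i
... | no _ = C r c

X′ : ∀ {n m} → Mat ℚ n m → Fin n → Fin m → Mat ℚ n m
X′ X i j k l with k FinP.≟ i | l FinP.≟ j
... | yes _ | yes _ = divℚ 1ℚ d
  where d = X i j ℚ.- toℚ (nearest (X i j))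
... | yes _ | no _ = divℚ (X i l) d
  where d = X i j ℚ.- toℚ (nearest (X i j))
... | no _ | yes _ = divℚ (ℚ.- frac (X k j)) d
  where d = X i j ℚ.- toℚ (nearest (X i j))
... | no _ | no _ = X k l ℚ.- divℚ (X i l ℚ.* frac (X k j)) d
  where d = X i j ℚ.- toℚ (nearest (X i j))

{-# OPTIONS --safe #-}
-- Put y := X_{·j} − c, where c_k = ⌊X_kj⌋ for k ≠ i and c_i = ⌈X_ij⌋. Since BX = C, the new
-- column is B′_i = C_j − Bc = By, so B′ = BE for the eta matrix E (the identity with column i
-- replaced by y). Its pivot y_i = X_ij − ⌈X_ij⌋ is nonzero because X_ij ∉ ℤ, so E⁻¹ is again an
-- eta matrix, with column i equal to 1/y_i at i and −y_k/y_i at k ≠ i. Hence B′⁻¹ = E⁻¹B⁻¹ and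
-- B′⁻¹C′ = E⁻¹(B⁻¹C′), where B⁻¹C′ is X with column j replaced by e_i. Left multiplication by
-- E⁻¹ adds ((E⁻¹)_ki − δ_ki) times row i to row k, which yields the formulas, as y_k = {X_kj}
-- for k ≠ i.
module Submission where

open import Defs
open import Algebra.Bundles using (CommutativeRing)
open import Data.Empty using (⊥-elim)
open import Data.Fin using (Fin; zero; suc)
import Data.Fin.Properties as FinP
open import Data.Integer as ℤ using (ℤ)
import Data.Integer.Properties as ℤP
open import Data.Nat as ℕ using (ℕ)
open import Data.Product using (Σ; _×_; _,_)
open import Data.Rational as ℚ using (ℚ; 0ℚ; 1ℚ; 1/_; NonZero; ≢-nonZero)
import Data.Rational.Properties as ℚP
open import Data.Rational.Solver using (module +-*-Solver)
import Data.Rational.Unnormalised as ℚᵘ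
import Data.Rational.Unnormalised.Properties as ℚᵘP
open import Function using (_∘_)
open import Relation.Nullary using (¬_; yes; no)
open import Relation.Binary.PropositionalEquality
open import Algebra.Properties.Semiring.Sum (CommutativeRing.semiring ℚP.+-*-commutativeRing)
  using (sum; sum-cong-≗; sum-replicate-zero; ∑-distrib-+; ∑-comm; *-distribˡ-sum; *-distribʳ-sum)
open import Algebra.Properties.Group ℚP.+-0-group using (x∙y⁻¹≈ε⇒x≈y)

open +-*-Solver

sumℚ≡sum : ∀ {n} (f : Fin n → ℚ) → sumℚ f ≡ sum f
sumℚ≡sum {ℕ.zero} f = refl
sumℚ≡sum {ℕ.suc n} f = cong (f zero ℚ.+_) (sumℚ≡sum (λ k → f (suc k)))

sumℚ-cong : ∀ {n} {f g : Fin n → ℚ} → (∀ k → f k ≡ g k) → sumℚ f ≡ sumℚ g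
sumℚ-cong {f = f} {g} f≗g = begin
  sumℚ f ≡⟨ sumℚ≡sum f ⟩
  sum f  ≡⟨ sum-cong-≗ f≗g ⟩
  sum g  ≡⟨ sumℚ≡sum g ⟨
  sumℚ g ∎
  where open ≡-Reasoning

sumℚ-distrib-+ : ∀ {n} (f g : Fin n → ℚ) →
  sumℚ (λ k → f k ℚ.+ g k) ≡ sumℚ f ℚ.+ sumℚ g
sumℚ-distrib-+ f g = begin
  sumℚ (λ k → f k ℚ.+ g k) ≡⟨ sumℚ≡sum (λ k → f k ℚ.+ g k) ⟩
  sum (λ k → f k ℚ.+ g k)  ≡⟨ ∑-distrib-+ f g ⟩
  sum f ℚ.+ sum g          ≡⟨ cong₂ ℚ._+_ (sumℚ≡sum f) (sumℚ≡sum g) ⟨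
  sumℚ f ℚ.+ sumℚ g        ∎
  where open ≡-Reasoning

sumℚ-comm : ∀ {n m} (f : Fin n → Fin m → ℚ) →
  sumℚ (λ a → sumℚ (f a)) ≡ sumℚ (λ b → sumℚ (λ a → f a b))
sumℚ-comm f = begin
  sumℚ (λ a → sumℚ (f a))          ≡⟨ sumℚ≡sum (λ a → sumℚ (f a)) ⟩
  sum (λ a → sumℚ (f a))           ≡⟨ sum-cong-≗ (λ a → sumℚ≡sum (f a)) ⟩
  sum (λ a → sum (f a))            ≡⟨ ∑-comm f ⟩
  sum (λ b → sum (λ a → f a b))    ≡⟨ sum-cong-≗ (λ b → sumℚ≡sum (λ a → f a b)) ⟨
  sum (λ b → sumℚ (λ a → f a b))   ≡⟨ sumℚ≡sum (λ b → sumℚ (λ a → f a b)) ⟨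
  sumℚ (λ b → sumℚ (λ a → f a b))  ∎
  where open ≡-Reasoning

*-distribˡ-sumℚ : ∀ {n} x (f : Fin n → ℚ) → x ℚ.* sumℚ f ≡ sumℚ (λ k → x ℚ.* f k)
*-distribˡ-sumℚ x f = begin
  x ℚ.* sumℚ f             ≡⟨ cong (x ℚ.*_) (sumℚ≡sum f) ⟩
  x ℚ.* sum f              ≡⟨ *-distribˡ-sum x f ⟩
  sum (λ k → x ℚ.* f k)    ≡⟨ sumℚ≡sum (λ k → x ℚ.* f k) ⟨
  sumℚ (λ k → x ℚ.* f k)   ∎
  where open ≡-Reasoning

*-distribʳ-sumℚ : ∀ {n} x (f : Fin n → ℚ) → sumℚ f ℚ.* x ≡ sumℚ (λ k → f k ℚ.* x)
*-distribʳ-sumℚ x f = begin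
  sumℚ f ℚ.* x             ≡⟨ cong (ℚ._* x) (sumℚ≡sum f) ⟩
  sum f ℚ.* x              ≡⟨ *-distribʳ-sum x f ⟩
  sum (λ k → f k ℚ.* x)    ≡⟨ sumℚ≡sum (λ k → f k ℚ.* x) ⟨
  sumℚ (λ k → f k ℚ.* x)   ∎
  where open ≡-Reasoning

sumℚ-zero : ∀ n → sumℚ {n} (λ _ → 0ℚ) ≡ 0ℚ
sumℚ-zero n = trans (sumℚ≡sum {n} (λ _ → 0ℚ)) (sum-replicate-zero n)

sumℚ-supported-at : ∀ {n} (a : Fin n) (f : Fin n → ℚ) →
  (∀ k → k ≢ a → f k ≡ 0ℚ) → sumℚ f ≡ f a
sumℚ-supported-at {ℕ.suc n} zero f f≡0 = begin
  f zero ℚ.+ sumℚ (λ k → f (suc k)) ≡⟨ cong (f zero ℚ.+_) (sumℚ-cong (λ k → f≡0 (suc k) λ ())) ⟩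
  f zero ℚ.+ sumℚ {n} (λ _ → 0ℚ)    ≡⟨ cong (f zero ℚ.+_) (sumℚ-zero n) ⟩
  f zero ℚ.+ 0ℚ                      ≡⟨ ℚP.+-identityʳ (f zero) ⟩
  f zero                             ∎
  where open ≡-Reasoning
sumℚ-supported-at (suc a) f f≡0 = begin
  f zero ℚ.+ sumℚ (λ k → f (suc k)) ≡⟨ cong₂ ℚ._+_ (f≡0 zero λ ()) (sumℚ-supported-at a (λ k → f (suc k)) (λ k k≢a → f≡0 (suc k) (k≢a ∘ FinP.suc-injective))) ⟩
  0ℚ ℚ.+ f (suc a)                   ≡⟨ ℚP.+-identityˡ (f (suc a)) ⟩
  f (suc a)                          ∎
  where open ≡-Reasoning

infix 4 _≋_
_≋_ : ∀ {n m} → Mat ℚ n m → Mat ℚ n m → Set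
A ≋ A′ = ∀ r c → A r c ≡ A′ r c

Id-diag : ∀ {n} (r : Fin n) → Id r r ≡ 1ℚ
Id-diag r with r FinP.≟ r
... | yes _ = refl
... | no r≢r = ⊥-elim (r≢r refl)

Id-off : ∀ {n} {r c : Fin n} → r ≢ c → Id r c ≡ 0ℚ
Id-off {r = r} {c} r≢c with r FinP.≟ c
... | yes r≡c = ⊥-elim (r≢c r≡c)
... | no _ = refl

⊗-identityˡ : ∀ {n m} (A : Mat ℚ n m) → Id ⊗ A ≋ A
⊗-identityˡ A r c = begin
  sumℚ (λ k → Id r k ℚ.* A k c) ≡⟨ sumℚ-supported-at r _ (λ k k≢r → trans (cong (ℚ._* A k c) (Id-off (k≢r ∘ sym))) (ℚP.*-zeroˡ (A k c))) ⟩
  Id r r ℚ.* A r c              ≡⟨ cong (ℚ._* A r c) (Id-diag r) ⟩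
  1ℚ ℚ.* A r c                  ≡⟨ ℚP.*-identityˡ (A r c) ⟩
  A r c                         ∎
  where open ≡-Reasoning

⊗-identityʳ : ∀ {n m} (A : Mat ℚ n m) → A ⊗ Id ≋ A
⊗-identityʳ A r c = begin
  sumℚ (λ k → A r k ℚ.* Id k c) ≡⟨ sumℚ-supported-at c _ (λ k k≢c → trans (cong (A r k ℚ.*_) (Id-off k≢c)) (ℚP.*-zeroʳ (A r k))) ⟩
  A r c ℚ.* Id c c              ≡⟨ cong (A r c ℚ.*_) (Id-diag c) ⟩
  A r c ℚ.* 1ℚ                  ≡⟨ ℚP.*-identityʳ (A r c) ⟩
  A r c                         ∎
  where open ≡-Reasoning

⊗-assoc : ∀ {n m p q} (A : Mat ℚ n m) (B : Mat ℚ m p) (C : Mat ℚ p q) →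
  (A ⊗ B) ⊗ C ≋ A ⊗ (B ⊗ C)
⊗-assoc A B C r c = begin
  sumℚ (λ k → sumℚ (λ a → A r a ℚ.* B a k) ℚ.* C k c)
    ≡⟨ sumℚ-cong (λ k → *-distribʳ-sumℚ (C k c) (λ a → A r a ℚ.* B a k)) ⟩
  sumℚ (λ k → sumℚ (λ a → A r a ℚ.* B a k ℚ.* C k c))
    ≡⟨ sumℚ-comm (λ k a → A r a ℚ.* B a k ℚ.* C k c) ⟩
  sumℚ (λ a → sumℚ (λ k → A r a ℚ.* B a k ℚ.* C k c))
    ≡⟨ sumℚ-cong (λ a → sumℚ-cong (λ k → ℚP.*-assoc (A r a) (B a k) (C k c))) ⟩
  sumℚ (λ a → sumℚ (λ k → A r a ℚ.* (B a k ℚ.* C k c)))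
    ≡⟨ sumℚ-cong (λ a → *-distribˡ-sumℚ (A r a) (λ k → B a k ℚ.* C k c)) ⟨
  sumℚ (λ a → A r a ℚ.* sumℚ (λ k → B a k ℚ.* C k c))
    ∎
  where open ≡-Reasoning

⊗-congˡ : ∀ {n m p} {A A′ : Mat ℚ n m} (B : Mat ℚ m p) → A ≋ A′ → A ⊗ B ≋ A′ ⊗ B
⊗-congˡ B A≋A′ r c = sumℚ-cong (λ k → cong (ℚ._* B k c) (A≋A′ r k))

⊗-congʳ : ∀ {n m p} (A : Mat ℚ n m) {B B′ : Mat ℚ m p} → B ≋ B′ → A ⊗ B ≋ A ⊗ B′
⊗-congʳ A B≋B′ r c = sumℚ-cong (λ k → cong (A r k ℚ.*_) (B≋B′ k c))

IsInverse-respˡ : ∀ {n} {A A′ B : Mat ℚ n n} → A ≋ A′ → IsInverse A B → IsInverse A′ B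
IsInverse-respˡ {B = B} A≋A′ (AB≋Id , BA≋Id) =
  (λ r c → trans (sym (⊗-congˡ B A≋A′ r c)) (AB≋Id r c)) ,
  (λ r c → trans (sym (⊗-congʳ B A≋A′ r c)) (BA≋Id r c))

⊗-cancel-middle : ∀ {n} (P Q R S : Mat ℚ n n) → Q ⊗ R ≋ Id → P ⊗ S ≋ Id → (P ⊗ Q) ⊗ (R ⊗ S) ≋ Id
⊗-cancel-middle P Q R S QR≋Id PS≋Id r c = begin
  ((P ⊗ Q) ⊗ (R ⊗ S)) r c ≡⟨ ⊗-assoc P Q (R ⊗ S) r c ⟩
  (P ⊗ (Q ⊗ (R ⊗ S))) r c ≡⟨ ⊗-congʳ P (λ a b → sym (⊗-assoc Q R S a b)) r c ⟩
  (P ⊗ ((Q ⊗ R) ⊗ S)) r c ≡⟨ ⊗-congʳ P (⊗-congˡ S QR≋Id) r c ⟩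
  (P ⊗ (Id ⊗ S)) r c      ≡⟨ ⊗-congʳ P (⊗-identityˡ S) r c ⟩
  (P ⊗ S) r c             ≡⟨ PS≋Id r c ⟩
  Id r c                  ∎
  where open ≡-Reasoning

⊗-inverse : ∀ {n} (A A′ E E′ : Mat ℚ n n) → IsInverse A A′ → IsInverse E E′ →
  IsInverse (A ⊗ E) (E′ ⊗ A′)
⊗-inverse A A′ E E′ (AA′≋Id , A′A≋Id) (EE′≋Id , E′E≋Id) =
  ⊗-cancel-middle A E E′ A′ EE′≋Id AA′≋Id , ⊗-cancel-middle E′ A′ A E A′A≋Id E′E≋Id

setColumn : ∀ {A : Set} {n m} → Mat A n m → Fin m → (Fin n → A) → Mat A n m
setColumn M c v r c′ with c′ FinP.≟ c
... | yes _ = v r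
... | no _ = M r c′

_⊗ᵥ_ : ∀ {n m} → Mat ℚ n m → (Fin m → ℚ) → Fin n → ℚ
(A ⊗ᵥ v) r = sumℚ (λ k → A r k ℚ.* v k)

⊗-setColumn : ∀ {n m p} (A : Mat ℚ n m) (M : Mat ℚ m p) c v →
  A ⊗ setColumn M c v ≋ setColumn (A ⊗ M) c (A ⊗ᵥ v)
⊗-setColumn A M c v r c′ with c′ FinP.≟ c
... | yes _ = refl
... | no _ = refl

setColumn-Id-entry : ∀ {n} (i : Fin n) (y : Fin n → ℚ) r k →
  setColumn Id i y r k ≡ Id r k ℚ.+ (y r ℚ.- Id r i) ℚ.* Id i k
setColumn-Id-entry i y r k with k FinP.≟ i
... | yes refl = begin
  y r                                       ≡⟨ solve 2 (λ a b → a := b :+ (a :- b) :* con 1ℚ) refl (y r) (Id r i) ⟩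
  Id r i ℚ.+ (y r ℚ.- Id r i) ℚ.* 1ℚ       ≡⟨ cong (λ e → Id r i ℚ.+ (y r ℚ.- Id r i) ℚ.* e) (Id-diag i) ⟨
  Id r i ℚ.+ (y r ℚ.- Id r i) ℚ.* Id i i   ∎
  where open ≡-Reasoning
... | no k≢i = begin
  Id r k                                    ≡⟨ solve 2 (λ a s → a := a :+ s :* con 0ℚ) refl (Id r k) (y r ℚ.- Id r i) ⟩
  Id r k ℚ.+ (y r ℚ.- Id r i) ℚ.* 0ℚ       ≡⟨ cong (λ e → Id r k ℚ.+ (y r ℚ.- Id r i) ℚ.* e) (Id-off (k≢i ∘ sym)) ⟨
  Id r k ℚ.+ (y r ℚ.- Id r i) ℚ.* Id i k   ∎
  where open ≡-Reasoning

setColumn-Id-⊗ : ∀ {n m} (i : Fin n) (y : Fin n → ℚ) (A : Mat ℚ n m) r c →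
  (setColumn Id i y ⊗ A) r c ≡ (y r ℚ.- Id r i) ℚ.* A i c ℚ.+ A r c
setColumn-Id-⊗ i y A r c = begin
  sumℚ (λ k → setColumn Id i y r k ℚ.* A k c)
    ≡⟨ sumℚ-cong (λ k → trans (cong (ℚ._* A k c) (setColumn-Id-entry i y r k)) (distrib k)) ⟩
  sumℚ (λ k → Id r k ℚ.* A k c ℚ.+ s ℚ.* (Id i k ℚ.* A k c))
    ≡⟨ sumℚ-distrib-+ (λ k → Id r k ℚ.* A k c) (λ k → s ℚ.* (Id i k ℚ.* A k c)) ⟩
  (Id ⊗ A) r c ℚ.+ sumℚ (λ k → s ℚ.* (Id i k ℚ.* A k c))
    ≡⟨ cong ((Id ⊗ A) r c ℚ.+_) (*-distribˡ-sumℚ s (λ k → Id i k ℚ.* A k c)) ⟨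
  (Id ⊗ A) r c ℚ.+ s ℚ.* (Id ⊗ A) i c
    ≡⟨ cong₂ (λ a b → a ℚ.+ s ℚ.* b) (⊗-identityˡ A r c) (⊗-identityˡ A i c) ⟩
  A r c ℚ.+ s ℚ.* A i c
    ≡⟨ ℚP.+-comm (A r c) (s ℚ.* A i c) ⟩
  s ℚ.* A i c ℚ.+ A r c
    ∎
  where
  open ≡-Reasoning
  s : ℚ
  s = y r ℚ.- Id r i
  distrib : ∀ k → (Id r k ℚ.+ s ℚ.* Id i k) ℚ.* A k c ≡ Id r k ℚ.* A k c ℚ.+ s ℚ.* (Id i k ℚ.* A k c)
  distrib k = solve 4 (λ a s b x → (a :+ s :* b) :* x := a :* x :+ s :* (b :* x)) refl (Id r k) s (Id i k) (A k c)

setColumn-Id-⊗-setColumn-Id : ∀ {n} (i : Fin n) (y z : Fin n → ℚ) →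
  (∀ r → (y r ℚ.- Id r i) ℚ.* z i ℚ.+ z r ≡ Id r i) →
  setColumn Id i y ⊗ setColumn Id i z ≋ Id
setColumn-Id-⊗-setColumn-Id i y z column-i r c =
  trans (setColumn-Id-⊗ i y (setColumn Id i z) r c) (entry c)
  where
  entry : ∀ c → (y r ℚ.- Id r i) ℚ.* setColumn Id i z i c ℚ.+ setColumn Id i z r c ≡ Id r c
  entry c with c FinP.≟ i
  ... | yes refl = column-i r
  ... | no c≢i = begin
    (y r ℚ.- Id r i) ℚ.* Id i c ℚ.+ Id r c ≡⟨ cong (λ e → (y r ℚ.- Id r i) ℚ.* e ℚ.+ Id r c) (Id-off (c≢i ∘ sym)) ⟩
    (y r ℚ.- Id r i) ℚ.* 0ℚ ℚ.+ Id r c     ≡⟨ solve 2 (λ s a → s :* con 0ℚ :+ a := a) refl (y r ℚ.- Id r i) (Id r c) ⟩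
    Id r c                                 ∎
    where open ≡-Reasoning

pivotColumn : ∀ {n} → Fin n → (Fin n → ℚ) → ℚ → Fin n → ℚ
pivotColumn i y t r with r FinP.≟ i
... | yes _ = t
... | no _ = ℚ.- y r ℚ.* t

pivotColumn-pivot : ∀ {n} (i : Fin n) y t → pivotColumn i y t i ≡ t
pivotColumn-pivot i y t with i FinP.≟ i
... | yes _ = refl
... | no i≢i = ⊥-elim (i≢i refl)

setColumn-Id-inverse : ∀ {n} (i : Fin n) (y : Fin n → ℚ) t → y i ℚ.* t ≡ 1ℚ →
  IsInverse (setColumn Id i y) (setColumn Id i (pivotColumn i y t))
setColumn-Id-inverse i y t yᵢt≡1 =
  setColumn-Id-⊗-setColumn-Id i y z column-right ,
  setColumn-Id-⊗-setColumn-Id i z y column-left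
  where
  open ≡-Reasoning
  z : Fin _ → ℚ
  z = pivotColumn i y t

  column-right′ : ∀ r → (y r ℚ.- Id r i) ℚ.* t ℚ.+ z r ≡ Id r i
  column-right′ r with r FinP.≟ i
  ... | yes refl = trans (solve 2 (λ a t → (a :- con 1ℚ) :* t :+ t := a :* t) refl (y i) t) yᵢt≡1
  ... | no _ = solve 2 (λ a t → (a :- con 0ℚ) :* t :+ (:- a :* t) := con 0ℚ) refl (y r) t

  column-right : ∀ r → (y r ℚ.- Id r i) ℚ.* z i ℚ.+ z r ≡ Id r i
  column-right r = trans (cong (λ e → (y r ℚ.- Id r i) ℚ.* e ℚ.+ z r) (pivotColumn-pivot i y t)) (column-right′ r)

  column-left : ∀ r → (z r ℚ.- Id r i) ℚ.* y i ℚ.+ y r ≡ Id r i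
  column-left r with r FinP.≟ i
  ... | yes refl = trans (solve 2 (λ a t → (t :- con 1ℚ) :* a :+ a := a :* t) refl (y i) t) yᵢt≡1
  ... | no _ = begin
    (ℚ.- y r ℚ.* t ℚ.- 0ℚ) ℚ.* y i ℚ.+ y r ≡⟨ solve 3 (λ a b t → (:- a :* t :- con 0ℚ) :* b :+ a := a :* (con 1ℚ :- b :* t)) refl (y r) (y i) t ⟩
    y r ℚ.* (1ℚ ℚ.- y i ℚ.* t)             ≡⟨ cong (λ e → y r ℚ.* (1ℚ ℚ.- e)) yᵢt≡1 ⟩
    y r ℚ.* (1ℚ ℚ.- 1ℚ)                    ≡⟨ solve 1 (λ a → a :* (con 1ℚ :- con 1ℚ) := con 0ℚ) refl (y r) ⟩
    0ℚ                                     ∎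

toℚᵘ-toℚ : ∀ a → ℚ.toℚᵘ (toℚ a) ℚᵘ.≃ ℚᵘ.mkℚᵘ a 0
toℚᵘ-toℚ a = ℚP.toℚᵘ-fromℚᵘ (ℚᵘ.mkℚᵘ a 0)

toℚ-+ : ∀ a b → toℚ (a ℤ.+ b) ≡ toℚ a ℚ.+ toℚ b
toℚ-+ a b = ℚP.toℚᵘ-injective (begin
  ℚ.toℚᵘ (toℚ (a ℤ.+ b))                ≈⟨ toℚᵘ-toℚ (a ℤ.+ b) ⟩
  ℚᵘ.mkℚᵘ (a ℤ.+ b) 0                   ≈⟨ ℚᵘ.*≡* cross-multiplied ⟩
  ℚᵘ.mkℚᵘ a 0 ℚᵘ.+ ℚᵘ.mkℚᵘ b 0          ≈⟨ ℚᵘP.+-cong (toℚᵘ-toℚ a) (toℚᵘ-toℚ b) ⟨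
  ℚ.toℚᵘ (toℚ a) ℚᵘ.+ ℚ.toℚᵘ (toℚ b)    ≈⟨ ℚP.toℚᵘ-homo-+ (toℚ a) (toℚ b) ⟨
  ℚ.toℚᵘ (toℚ a ℚ.+ toℚ b)              ∎)
  where
  open ℚᵘP.≃-Reasoning
  cross-multiplied : (a ℤ.+ b) ℤ.* ℤ.+ 1 ≡ (a ℤ.* ℤ.+ 1 ℤ.+ b ℤ.* ℤ.+ 1) ℤ.* ℤ.+ 1
  cross-multiplied = cong (ℤ._* ℤ.+ 1) (cong₂ ℤ._+_ (sym (ℤP.*-identityʳ a)) (sym (ℤP.*-identityʳ b)))

toℚ-* : ∀ a b → toℚ (a ℤ.* b) ≡ toℚ a ℚ.* toℚ b
toℚ-* a b = ℚP.toℚᵘ-injective (begin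
  ℚ.toℚᵘ (toℚ (a ℤ.* b))                ≈⟨ toℚᵘ-toℚ (a ℤ.* b) ⟩
  ℚᵘ.mkℚᵘ (a ℤ.* b) 0                   ≡⟨⟩
  ℚᵘ.mkℚᵘ a 0 ℚᵘ.* ℚᵘ.mkℚᵘ b 0          ≈⟨ ℚᵘP.*-cong (toℚᵘ-toℚ a) (toℚᵘ-toℚ b) ⟨
  ℚ.toℚᵘ (toℚ a) ℚᵘ.* ℚ.toℚᵘ (toℚ b)    ≈⟨ ℚP.toℚᵘ-homo-* (toℚ a) (toℚ b) ⟨
  ℚ.toℚᵘ (toℚ a ℚ.* toℚ b)              ∎)
  where open ℚᵘP.≃-Reasoning

toℚ-neg : ∀ a → toℚ (ℤ.- a) ≡ ℚ.- toℚ a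
toℚ-neg a = ℚP.toℚᵘ-injective (begin
  ℚ.toℚᵘ (toℚ (ℤ.- a))     ≈⟨ toℚᵘ-toℚ (ℤ.- a) ⟩
  ℚᵘ.mkℚᵘ (ℤ.- a) 0        ≡⟨⟩
  ℚᵘ.- ℚᵘ.mkℚᵘ a 0         ≈⟨ ℚᵘP.-‿cong (toℚᵘ-toℚ a) ⟨
  ℚᵘ.- ℚ.toℚᵘ (toℚ a)      ≈⟨ ℚP.toℚᵘ-homo‿- (toℚ a) ⟨
  ℚ.toℚᵘ (ℚ.- toℚ a)       ∎)
  where open ℚᵘP.≃-Reasoning

toℚ-- : ∀ a b → toℚ (a ℤ.- b) ≡ toℚ a ℚ.- toℚ b
toℚ-- a b = trans (toℚ-+ a (ℤ.- b)) (cong (toℚ a ℚ.+_) (toℚ-neg b))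

toℚ-sumℤ : ∀ {n} (f : Fin n → ℤ) → toℚ (sumℤ f) ≡ sumℚ (λ k → toℚ (f k))
toℚ-sumℤ {ℕ.zero} f = refl
toℚ-sumℤ {ℕ.suc n} f =
  trans (toℚ-+ (f zero) _) (cong (toℚ (f zero) ℚ.+_) (toℚ-sumℤ (λ k → f (suc k))))

divℚ≡*1/ : ∀ p q .{{_ : NonZero q}} → divℚ p q ≡ p ℚ.* 1/ q
divℚ≡*1/ p q {{q≢0}} with q ℚP.≟ 0ℚ
... | yes refl = ⊥-elim (ℕ.≢-nonZero⁻¹ 0 {{q≢0}} refl)
... | no _ = refl

¬IsInt⇒-toℚ≢0 : ∀ {x} → ¬ IsInt x → ∀ z → x ℚ.- toℚ z ≢ 0ℚ
¬IsInt⇒-toℚ≢0 {x} x∉ℤ z x-z≡0 = x∉ℤ (z , x∙y⁻¹≈ε⇒x≈y x (toℚ z) x-z≡0)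

residue : ∀ {n m} → Mat ℚ n m → Fin n → Fin m → Fin n → ℚ
residue X i j k = X k j ℚ.- toℚ (coeff X i j k)

roundingError : ∀ {n m} → Mat ℚ n m → Fin n → Fin m → ℚ
roundingError X i j = X i j ℚ.- toℚ (nearest (X i j))

residue-pivot : ∀ {n m} (X : Mat ℚ n m) i j → residue X i j i ≡ roundingError X i j
residue-pivot X i j with i FinP.≟ i
... | yes _ = refl
... | no i≢i = ⊥-elim (i≢i refl)

residue-off-pivot : ∀ {n m} (X : Mat ℚ n m) i j k → k ≢ i → residue X i j k ≡ frac (X k j)
residue-off-pivot X i j k k≢i with k FinP.≟ i
... | yes k≡i = ⊥-elim (k≢i k≡i)
... | no _ = refl

B′-factorisation : ∀ {n m} (B : Mat ℤ n n) (C : Mat ℤ n m) (X : Mat ℚ n m) i j →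
  (∀ r → (toℚMat B ⊗ X) r j ≡ toℚ (C r j)) →
  toℚMat B ⊗ setColumn Id i (residue X i j) ≋ toℚMat (B′ B C X i j)
B′-factorisation B C X i j BX≡C r c =
  trans (⊗-setColumn BQ Id i (residue X i j) r c) (entry c)
  where
  open ≡-Reasoning
  BQ : Mat ℚ _ _
  BQ = toℚMat B
  c′ : Fin _ → ℚ
  c′ k = toℚ (coeff X i j k)

  new-column : (BQ ⊗ᵥ residue X i j) r ≡ toℚ (C r j ℤ.- sumℤ (λ k → B r k ℤ.* coeff X i j k))
  new-column = begin
    sumℚ (λ k → BQ r k ℚ.* (X k j ℚ.- c′ k))
      ≡⟨ sumℚ-cong (λ k → solve 3 (λ b x c → b :* (x :- c) := b :* x :+ con (ℚ.- 1ℚ) :* (b :* c)) refl (BQ r k) (X k j) (c′ k)) ⟩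
    sumℚ (λ k → BQ r k ℚ.* X k j ℚ.+ ℚ.- 1ℚ ℚ.* (BQ r k ℚ.* c′ k))
      ≡⟨ sumℚ-distrib-+ (λ k → BQ r k ℚ.* X k j) (λ k → ℚ.- 1ℚ ℚ.* (BQ r k ℚ.* c′ k)) ⟩
    (BQ ⊗ X) r j ℚ.+ sumℚ (λ k → ℚ.- 1ℚ ℚ.* (BQ r k ℚ.* c′ k))
      ≡⟨ cong₂ ℚ._+_ (BX≡C r) (sym (*-distribˡ-sumℚ (ℚ.- 1ℚ) (λ k → BQ r k ℚ.* c′ k))) ⟩
    toℚ (C r j) ℚ.+ ℚ.- 1ℚ ℚ.* sumℚ (λ k → BQ r k ℚ.* c′ k)
      ≡⟨ solve 2 (λ a s → a :+ con (ℚ.- 1ℚ) :* s := a :- s) refl (toℚ (C r j)) (sumℚ (λ k → BQ r k ℚ.* c′ k)) ⟩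
    toℚ (C r j) ℚ.- sumℚ (λ k → BQ r k ℚ.* c′ k)
      ≡⟨ cong (λ s → toℚ (C r j) ℚ.- s) (trans (toℚ-sumℤ (λ k → B r k ℤ.* coeff X i j k)) (sumℚ-cong (λ k → toℚ-* (B r k) (coeff X i j k)))) ⟨
    toℚ (C r j) ℚ.- toℚ (sumℤ (λ k → B r k ℤ.* coeff X i j k))
      ≡⟨ toℚ-- (C r j) (sumℤ (λ k → B r k ℤ.* coeff X i j k)) ⟨
    toℚ (C r j ℤ.- sumℤ (λ k → B r k ℤ.* coeff X i j k))
      ∎

  entry : ∀ c → setColumn (BQ ⊗ Id) i (BQ ⊗ᵥ residue X i j) r c ≡ toℚ (B′ B C X i j r c)
  entry c with c FinP.≟ i
  ... | yes _ = new-column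
  ... | no _ = ⊗-identityʳ BQ r c

left-inverse-⊗-C′ : ∀ {n m} (B : Mat ℤ n n) (C : Mat ℤ n m) (Binv : Mat ℚ n n) i j →
  Binv ⊗ toℚMat B ≋ Id →
  Binv ⊗ toℚMat (C′ B C i j) ≋ setColumn (Binv ⊗ toℚMat C) j (λ r → Id r i)
left-inverse-⊗-C′ B C Binv i j BinvB≋Id r c =
  trans (⊗-congʳ Binv C′≋ r c) (trans (⊗-setColumn Binv (toℚMat C) j _ r c) (entry c))
  where
  C′≋ : toℚMat (C′ B C i j) ≋ setColumn (toℚMat C) j (λ k → toℚ (B k i))
  C′≋ k c with c FinP.≟ j
  ... | yes _ = refl
  ... | no _ = refl

  entry : ∀ c → setColumn (Binv ⊗ toℚMat C) j (Binv ⊗ᵥ (λ k → toℚ (B k i))) r c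
              ≡ setColumn (Binv ⊗ toℚMat C) j (λ r → Id r i) r c
  entry c with c FinP.≟ j
  ... | yes _ = BinvB≋Id r i
  ... | no _ = refl

X′-entries : ∀ {n m} (X : Mat ℚ n m) i j .{{_ : NonZero (roundingError X i j)}} →
  setColumn Id i (pivotColumn i (residue X i j) (1/ roundingError X i j)) ⊗ setColumn X j (λ r → Id r i) ≋ X′ X i j
X′-entries X i j k l = trans (setColumn-Id-⊗ i (pivotColumn i (residue X i j) t) Z k l) (entry k l)
  where
  open ≡-Reasoning
  d t : ℚ
  d = roundingError X i j
  t = 1/ d
  Z : Mat ℚ _ _
  Z = setColumn X j (λ r → Id r i)

  entry : ∀ k l → (pivotColumn i (residue X i j) t k ℚ.- Id k i) ℚ.* Z i l ℚ.+ Z k l ≡ X′ X i j k l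
  entry k l with k FinP.≟ i | l FinP.≟ j
  ... | yes refl | yes refl = begin
    (t ℚ.- 1ℚ) ℚ.* Id i i ℚ.+ Id i i ≡⟨ cong (λ e → (t ℚ.- 1ℚ) ℚ.* e ℚ.+ e) (Id-diag i) ⟩
    (t ℚ.- 1ℚ) ℚ.* 1ℚ ℚ.+ 1ℚ         ≡⟨ solve 1 (λ t → (t :- con 1ℚ) :* con 1ℚ :+ con 1ℚ := con 1ℚ :* t) refl t ⟩
    1ℚ ℚ.* t                         ≡⟨ divℚ≡*1/ 1ℚ d ⟨
    divℚ 1ℚ d                        ∎
  ... | yes refl | no _ = begin
    (t ℚ.- 1ℚ) ℚ.* X i l ℚ.+ X i l   ≡⟨ solve 2 (λ t x → (t :- con 1ℚ) :* x :+ x := x :* t) refl t (X i l) ⟩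
    X i l ℚ.* t                      ≡⟨ divℚ≡*1/ (X i l) d ⟨
    divℚ (X i l) d                   ∎
  ... | no k≢i | yes refl
    rewrite residue-off-pivot X i j k k≢i | Id-diag i | Id-off k≢i = begin
    (ℚ.- frac (X k j) ℚ.* t ℚ.- 0ℚ) ℚ.* 1ℚ ℚ.+ 0ℚ     ≡⟨ solve 2 (λ f t → (:- f :* t :- con 0ℚ) :* con 1ℚ :+ con 0ℚ := :- f :* t) refl (frac (X k j)) t ⟩
    ℚ.- frac (X k j) ℚ.* t                          ≡⟨ divℚ≡*1/ (ℚ.- frac (X k j)) d ⟨
    divℚ (ℚ.- frac (X k j)) d                       ∎
  ... | no k≢i | no _ rewrite residue-off-pivot X i j k k≢i = begin
    (ℚ.- frac (X k j) ℚ.* t ℚ.- 0ℚ) ℚ.* X i l ℚ.+ X k l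
      ≡⟨ solve 4 (λ f t x y → (:- f :* t :- con 0ℚ) :* x :+ y := y :- (x :* f) :* t) refl (frac (X k j)) t (X i l) (X k l) ⟩
    X k l ℚ.- (X i l ℚ.* frac (X k j)) ℚ.* t
      ≡⟨ cong (λ s → X k l ℚ.- s) (divℚ≡*1/ (X i l ℚ.* frac (X k j)) d) ⟨
    X k l ℚ.- divℚ (X i l ℚ.* frac (X k j)) d
      ∎

mainTheorem4 : (n m : ℕ) (B : Mat ℤ n n) (C : Mat ℤ n m)
    → (Binv : Mat ℚ n n) → IsInverse (toℚMat B) Binv
    → (i : Fin n) (j : Fin m)
    → ¬ IsInt ((Binv ⊗ toℚMat C) i j)
    → Σ (Mat ℚ n n) (λ B′inv →
        IsInverse (toℚMat (B′ B C (Binv ⊗ toℚMat C) i j)) B′inv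
        × (∀ k l → (B′inv ⊗ toℚMat (C′ B C i j)) k l ≡ X′ (Binv ⊗ toℚMat C) i j k l))
mainTheorem4 n m B C Binv inv@(BBinv≋Id , BinvB≋Id) i j Xᵢⱼ∉ℤ = E⁻¹ ⊗ Binv , B′-inverse , B′⁻¹C′≋X′
  where
  open ≡-Reasoning
  X : Mat ℚ n m
  X = Binv ⊗ toℚMat C

  instance
    roundingError≢0 : NonZero (roundingError X i j)
    roundingError≢0 = ≢-nonZero (¬IsInt⇒-toℚ≢0 Xᵢⱼ∉ℤ (nearest (X i j)))

  E⁻¹ : Mat ℚ n n
  E⁻¹ = setColumn Id i (pivotColumn i (residue X i j) (1/ roundingError X i j))

  E-inverse : IsInverse (setColumn Id i (residue X i j)) E⁻¹
  E-inverse = setColumn-Id-inverse i (residue X i j) (1/ roundingError X i j)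
    (trans (cong (ℚ._* 1/ roundingError X i j) (residue-pivot X i j)) (ℚP.*-inverseʳ (roundingError X i j)))

  BX≡C : ∀ r → (toℚMat B ⊗ X) r j ≡ toℚ (C r j)
  BX≡C r = begin
    (toℚMat B ⊗ (Binv ⊗ toℚMat C)) r j ≡⟨ ⊗-assoc (toℚMat B) Binv (toℚMat C) r j ⟨
    ((toℚMat B ⊗ Binv) ⊗ toℚMat C) r j ≡⟨ ⊗-congˡ (toℚMat C) BBinv≋Id r j ⟩
    (Id ⊗ toℚMat C) r j                ≡⟨ ⊗-identityˡ (toℚMat C) r j ⟩
    toℚ (C r j)                        ∎

  B′-inverse : IsInverse (toℚMat (B′ B C X i j)) (E⁻¹ ⊗ Binv)
  B′-inverse = IsInverse-respˡ (B′-factorisation B C X i j BX≡C) (⊗-inverse (toℚMat B) Binv (setColumn Id i (residue X i j)) E⁻¹ inv E-inverse)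

  B′⁻¹C′≋X′ : (E⁻¹ ⊗ Binv) ⊗ toℚMat (C′ B C i j) ≋ X′ X i j
  B′⁻¹C′≋X′ k l = begin
    ((E⁻¹ ⊗ Binv) ⊗ toℚMat (C′ B C i j)) k l ≡⟨ ⊗-assoc E⁻¹ Binv (toℚMat (C′ B C i j)) k l ⟩
    (E⁻¹ ⊗ (Binv ⊗ toℚMat (C′ B C i j))) k l ≡⟨ ⊗-congʳ E⁻¹ (left-inverse-⊗-C′ B C Binv i j BinvB≋Id) k l ⟩
    (E⁻¹ ⊗ setColumn X j (λ r → Id r i)) k l ≡⟨ X′-entries X i j k l ⟩
    X′ X i j k l                             ∎
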